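{- Let $S\subseteq\mathbb{Z}$ be a finite set satisfying $S=-S$ and ($\forall s,t\in\mathbb{N}\setminus S$, $s+t\notin S$), let $m=\max(S)$, let $n\ge 1$ and let $(T,\mu)\in\overline{\mathcal{T}}_m^n$. (1) If $0\in S$, then $(T,\mu)$ is $\mathcal{A}_S^n$-connected if and only if every block $B$ of $(T,\mu)$ satisfies $\mathrm{shadow}(B)\in\mathcal{D}_S$. (2) If $0\notin S$, then $(T,\mu)$ is $\mathcal{A}_S^n$-connected if and only if every block $B$ of $(T,\mu)$ satisfies $\mathrm{shadow}(B)\in\mathcal{D}_S$ and ($|\mathrm{shadow}(B)|>1$ or $|B|=1$).
   Context: $\mathbb{N}=\{0,1,\dots\}$, $[a;b]=\{k\in\mathbb{Z}:a\le k\le b\}$, $[n]=[1;n]$. $\{x_i-x_j=s\}=\{x\in\mathbb{R}^n:x_i-x_j=s\}$; $\mathcal{A}_S^n=\{\{x_i-x_j=s\}:1\le i<j\le n,\ s\in S\}$. An $(m,n)$-tree is a rooted plane tree in which each node has exactly $m+1$ ordered children ($0$-child, ..., $m$-child), each a node or a leaf, with $n$ nodes labeled bijectively by $[n]$. Node $i$ is the $s$-cadet of $j$ if $i$ is the $s$-child of $j$ and the $t$-child of $j$ is a leaf for all $t\in[s+1;m]$; $\{i,j\}$ is then a cadet edge. For a vertex $v$ with root-to-$v$ path $v_0,\dots,v_k=v$, $\mathrm{drift}_T(v)=\sum_i s_i$ where $v_i$ is the $s_i$-child of $v_{i-1}$. A marked $(m,n)$-tree is $(T,\mu)$ with $\mu$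 a set of cadet edges such that if $\{j,i\}\in\mu$ with $i$ the $0$-cadet of $j$ then $j<i$; $\overline{\mathcal{T}}_m^n$ is the set of these. $i\overset{\mu}{\sim}j$ iff $i=j$ or every edge on the tree path between $i,j$ is in $\mu$; the classes are the blocks (each block is a path of marked cadet edges and has a node $a$ that is an ancestor of all its nodes). $(T,\mu)$ is $\mathcal{A}$-connected (for an arrangement $\mathcal{A}$) if for each block $B$ the graph on $B$ with edges $\{i,j\}$ such that $\{x_i-x_j=\mathrm{drift}_T(i)-\mathrm{drift}_T(j)\}\in\mathcal{A}$ is connected. The shadow of a block $B$ is $\mathrm{shadow}(B)=\{\mathrm{drift}_T(j)-\mathrm{drift}_T(a): j\in B\}$, with $a\in B$ the ancestor of all nodes of $B$. An $S$-shadow is a finite set $D\subseteq\mathbb{N}$ with $0\in D$ such that the graph with vertex set $D$ and edges $\{i,j\}$ ($i,j\in D$, $i-j\in S$) is connected; $\mathcal{D}_S$ is the set of $S$-shadows. -}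

module Defs where

open import Data.Nat using (ℕ; zero; suc; _+_; _≤_; _<_)
open import Data.Integer as ℤ using (ℤ; +_; -_; _-_)
open import Data.Fin using (Fin; toℕ)
open import Data.List using (List; []; _∷_; concatMap; allFin; map; upTo; length)
open import Data.List.Membership.Propositional using (_∈_; _∉_)
open import Data.List.Relation.Unary.Unique.Propositional using (Unique)
open import Data.List.Relation.Binary.Permutation.Propositional using (_↭_)
open import Data.Product using (Σ; ∃; _×_; _,_)
open import Data.Sum using (_⊎_)
open import Relation.Binary.PropositionalEquality using (_≡_; _≢_)

HasSize : {A : Set} → (A → Set) → ℕ → Set
HasSize {A} P k = Σ (List A) λ xs →
  Unique xs × (∀ x → x ∈ xs → P x) × (∀ x → P x → x ∈ xs) × length xs ≡ k

Finite : {A : Set} → (A → Set) → Set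
Finite P = ∃ λ k → HasSize P k

data Reach {A : Set} (V : A → Set) (E : A → A → Set) : A → A → Set where
  stop : ∀ {x} → Reach V E x x
  step : ∀ {x y z} → E x y → V y → Reach V E y z → Reach V E x z

Connected : {A : Set} → (A → Set) → (A → A → Set) → Set
Connected V E = ∀ x y → V x → V y → Reach V E x y

InRange : ℕ → ℕ → Set
InRange n i = 1 ≤ i × i ≤ n

SymmetricSet : List ℤ → Set
SymmetricSet S = ∀ z → (z ∈ S → (- z) ∈ S) × ((- z) ∈ S → z ∈ S)

ComplSumAvoids : List ℤ → Set
ComplSumAvoids S = ∀ s t → (+ s) ∉ S → (+ t) ∉ S → (+ (s + t)) ∉ S

IsMax : List ℤ → ℕ → Set
IsMax S m = (+ m) ∈ S × (∀ z → z ∈ S → z ℤ.≤ (+ m))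

data Tree (m : ℕ) : Set where
  leaf : Tree m
  node : ℕ → (Fin (suc m) → Tree m) → Tree m

labels : ∀ {m} → Tree m → List ℕ
labels leaf = []
labels {m} (node i c) = i ∷ concatMap (λ k → labels (c k)) (allFin (suc m))

LabeledBy : ∀ {m} → ℕ → Tree m → Set
LabeledBy n T = labels T ↭ map suc (upTo n)

RootIs : ∀ {m} → ℕ → Tree m → Set
RootIs i t = ∃ λ c → t ≡ node i c

data NodeIn {m} (j : ℕ) (c : Fin (suc m) → Tree m) : Tree m → Set where
  here  : NodeIn j c (node j c)
  there : ∀ {l d} (k : Fin (suc m)) → NodeIn j c (d k) → NodeIn j c (node l d)

Occurs : ∀ {m} → ℕ → Tree m → Set
Occurs j t = ∃ λ c → NodeIn j c t

data Drift {m} (j : ℕ) : ℕ → Tree m → Set where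
  here  : ∀ {c} → Drift j 0 (node j c)
  there : ∀ {l d e} (k : Fin (suc m)) → Drift j e (d k) →
          Drift j (toℕ k + e) (node l d)

ChildOf : ∀ {m} → Tree m → Fin (suc m) → ℕ → ℕ → Set
ChildOf T s i j = ∃ λ c → NodeIn j c T × RootIs i (c s)

Cadet : ∀ {m} → Tree m → Fin (suc m) → ℕ → ℕ → Set
Cadet T s i j = ∃ λ c → NodeIn j c T × RootIs i (c s) ×
  (∀ t → toℕ s < toℕ t → c t ≡ leaf)

-- a is an ancestor of j (or j itself)
Ancestor : ∀ {m} → Tree m → ℕ → ℕ → Set
Ancestor T a j = ∃ λ c → NodeIn a c T × Occurs j (node a c)

Adj : ∀ {m} → Tree m → ℕ → ℕ → Set
Adj T x y = ∃ λ s → ChildOf T s x y ⊎ ChildOf T s y x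

-- Marked trees.  The set of marked edges μ is given as a list of pairs
-- (j , i), each standing for the cadet edge {j,i} with i a cadet of j.

InMu : List (ℕ × ℕ) → ℕ → ℕ → Set
InMu μ x y = (x , y) ∈ μ ⊎ (y , x) ∈ μ

MarkedTree : (m n : ℕ) → Tree m → List (ℕ × ℕ) → Set
MarkedTree m n T μ = LabeledBy n T ×
  (∀ j i → (j , i) ∈ μ → Σ (Fin (suc m)) λ s → Cadet T s i j × (toℕ s ≡ 0 → j < i))

data PathIn (E : ℕ → ℕ → Set) : ℕ → ℕ → List ℕ → Set where
  one  : ∀ {x} → PathIn E x x (x ∷ [])
  cons : ∀ {x y z vs} → E x y → PathIn E y z vs → PathIn E x z (x ∷ vs)

-- the tree path between x and z: the (unique) simple path in T
TreePath : ∀ {m} → Tree m → ℕ → ℕ → List ℕ → Set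
TreePath T x z vs = PathIn (Adj T) x z vs × Unique vs

data EdgesIn (μ : List (ℕ × ℕ)) : List ℕ → Set where
  nil  : EdgesIn μ []
  sing : ∀ {x} → EdgesIn μ (x ∷ [])
  cons : ∀ {x y vs} → InMu μ x y → EdgesIn μ (y ∷ vs) → EdgesIn μ (x ∷ y ∷ vs)

MuRel : ∀ {m} → Tree m → List (ℕ × ℕ) → ℕ → ℕ → Set
MuRel T μ i j = i ≡ j ⊎ (∀ vs → TreePath T i j vs → EdgesIn μ vs)

-- the block of i ∈ [n] (as a subset of [n]); every block is of this form
Block : ∀ {m} → Tree m → List (ℕ × ℕ) → ℕ → ℕ → ℕ → Set
Block T μ n i j = InRange n j × MuRel T μ i j

-- The arrangement A_S^n: membership of the hyperplane {x_a - x_b = c}.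
-- {x_a - x_b = c} = {x_i - x_j = s} with i<j iff (a,b,c) = (i,j,s) or
-- (a,b,c) = (j,i,-s).
InArrangement : List ℤ → ℕ → ℕ → ℕ → ℤ → Set
InArrangement S n a b c =
  (1 ≤ a × a < b × b ≤ n × c ∈ S) ⊎ (1 ≤ b × b < a × a ≤ n × (- c) ∈ S)

-- edge {i,j} of the graph on a block: {x_i - x_j = drift(i) - drift(j)} ∈ A
DriftEdge : ∀ {m} → List ℤ → ℕ → Tree m → ℕ → ℕ → Set
DriftEdge S n T i j = ∃ λ di → ∃ λ dj →
  Drift i di T × Drift j dj T × InArrangement S n i j ((+ di) - (+ dj))

AConnected : ∀ {m} → List ℤ → ℕ → Tree m → List (ℕ × ℕ) → Set
AConnected S n T μ =
  ∀ i → InRange n i → Connected (Block T μ n i) (DriftEdge S n T)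

-- d ∈ shadow(B) for the block B of i, where a ∈ B is the ancestor of all of B
Shadow : ∀ {m} → Tree m → List (ℕ × ℕ) → ℕ → ℕ → ℕ → Set
Shadow T μ n i d = ∃ λ a → Block T μ n i a × (∀ j → Block T μ n i j → Ancestor T a j) ×
  ∃ λ j → Block T μ n i j × ∃ λ da → ∃ λ dj →
    Drift a da T × Drift j dj T × dj ≡ da + d

IsSShadow : List ℤ → (ℕ → Set) → Set
IsSShadow S D = Finite D × D 0 × Connected D (λ i j → ((+ i) - (+ j)) ∈ S)

{-# OPTIONS --safe #-}

-- Let a be the top node of a block B, i.e. its common ancestor, with drift da. Subtracting da
-- maps B onto its shadow, and two distinct nodes of B are adjacent exactly when their offsets
-- differ by an element of S (as S = -S). Hence walks in B project to walks in the shadow graph,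
-- and walks in the shadow graph lift to B once nodes of equal drift are joined: directly if
-- 0 ∈ S; if 0 ∉ S, through a node whose offset neighbours theirs, which exists when the shadow
-- has a second element, while a one-node block needs nothing. Conversely, if 0 ∉ S and the
-- shadow is a single point, B has no edges, so if connected it is {i}. Combinatorially, B
-- consists of the nodes joined to a by marked parent edges; this makes blocks decidable (so
-- shadows are finite) and shows that a is an ancestor of all of B.

module Submission where

open import Data.Nat using (ℕ; suc; _+_; _≤_; _<_; z≤n; s≤s)
open import Data.Nat.Properties
  using (_≟_; _≤?_; _<?_; <-cmp; suc-injective; +-comm; +-identityʳ; +-cancelˡ-≡;
         ≤-refl; ≤-reflexive; ≤-trans; ≤-antisym; ≤-pred; ≰⇒>; m≤m+n; n≤1+n; n<1+n; <-irrefl)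
open import Data.Nat.ListAction using (sum)
open import Data.Nat.ListAction.Properties using (sum-++)
open import Data.Fin using (Fin; toℕ) renaming (_≟_ to _≟ᶠ_)
open import Data.Integer using (ℤ; +_; _-_; _⊖_)
open import Data.Integer.Properties using (m-n≡m⊖n; +-cancelˡ-⊖; +-inverseʳ; +-0-abelianGroup)
open import Algebra.Properties.AbelianGroup +-0-abelianGroup using (⁻¹-anti-homo‿-)
open import Data.List
  using (List; []; _∷_; _++_; _∷ʳ_; length; map; concatMap; allFin; upTo; filter; deduplicate)
open import Data.List.Properties using (map-++; length-++; ∷ʳ-injective)
open import Data.List.Membership.Propositional using (_∈_; _∉_; lose; find; mapWith∈)
open import Data.List.Membership.Propositional.Properties
  using (∈-map⁺; ∈-map⁻; ∈-upTo⁺; ∈-upTo⁻; ∈-filter⁺; ∈-filter⁻; ∈-allFin;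
         ∈-concatMap⁺; ∈-concatMap⁻; ∈-deduplicate⁺; ∈-deduplicate⁻)
open import Data.List.Membership.DecPropositional _≟_ using (_∈?_)
open import Data.List.Relation.Unary.Any using (here; there; satisfied; any?)
open import Data.List.Relation.Unary.Any.Properties using (mapWith∈⁺; mapWith∈⁻)
open import Data.List.Relation.Unary.All using (All; []; _∷_) renaming (lookup to lookupᴬ)
open import Data.List.Relation.Unary.All.Properties using (++⁻ˡ; ++⁻ʳ; ¬Any⇒All¬)
open import Data.List.Relation.Unary.AllPairs using ([]; _∷_)
open import Data.List.Relation.Unary.Unique.Propositional using (Unique)
open import Data.List.Relation.Unary.Unique.Propositional.Properties using (map⁺; upTo⁺; filter⁺)
open import Data.List.Relation.Unary.Unique.DecPropositional.Properties _≟_ using (deduplicate-!)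
open import Data.List.Relation.Binary.Permutation.Propositional using (↭-sym; ↭⇒↭ₛ)
open import Data.List.Relation.Binary.Permutation.Propositional.Properties using (∈-resp-↭)
open import Data.List.Relation.Binary.Permutation.Setoid.Properties using (Unique-resp-↭)
open import Data.Product using (Σ; ∃; _×_; _,_; proj₁; proj₂)
open import Data.Sum using (_⊎_; inj₁; inj₂; [_,_]′)
open import Data.Empty using (⊥; ⊥-elim)
open import Function using (_∘_; _⇔_; mk⇔)
open import Relation.Nullary using (Dec; yes; no; ¬_)
open import Relation.Nullary.Decidable using (_×-dec_)
open import Relation.Binary using (tri<; tri≈; tri>)
open import Relation.Binary.Definitions using (DecidableEquality; Symmetric)
open import Relation.Binary.PropositionalEquality
  using (_≡_; _≢_; refl; sym; trans; cong; subst; setoid; module ≡-Reasoning)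

open import Defs

module _ {A : Set} where

  Unique-++⁻ : (xs : List A) {ys : List A} → Unique (xs ++ ys) →
               Unique xs × Unique ys × (∀ {z} → z ∈ xs → z ∉ ys)
  Unique-++⁻ []       u        = [] , u , λ ()
  Unique-++⁻ (x ∷ xs) (x∉ ∷ u) with Unique-++⁻ xs u
  ... | uxs , uys , disjoint = ++⁻ˡ xs x∉ ∷ uxs , uys , λ where
    (here refl)  z∈ys → lookupᴬ (++⁻ʳ xs x∉) z∈ys refl
    (there z∈xs) z∈ys → disjoint z∈xs z∈ys

  length≤1⇒≡ : ∀ {xs : List A} {x y} → length xs ≤ 1 → x ∈ xs → y ∈ xs → x ≡ y
  length≤1⇒≡ {_ ∷ []}    _         (here refl) (here refl) = refl
  length≤1⇒≡ {_ ∷ _ ∷ _} (s≤s ()) _           _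

  HasSize≤1⇒≡ : ∀ {P : A → Set} {k} → HasSize P k → k ≤ 1 → ∀ {x y} → P x → P y → x ≡ y
  HasSize≤1⇒≡ (_ , _ , _ , P⊆xs , refl) k≤1 px py = length≤1⇒≡ k≤1 (P⊆xs _ px) (P⊆xs _ py)

  ∃-other-member : DecidableEquality A → ∀ {xs} → Unique xs → 2 ≤ length xs →
                   ∀ d → ∃ λ d′ → d′ ∈ xs × d′ ≢ d
  ∃-other-member _≟ᴬ_ {x ∷ y ∷ _} ((x≢y ∷ _) ∷ _) _ d with x ≟ᴬ d
  ... | yes refl = y , there (here refl) , λ y≡x → x≢y (sym y≡x)
  ... | no  x≢d  = x , here refl , x≢d
  ∃-other-member _ {_ ∷ []} _ (s≤s ()) _

module _ {A B : Set} (f : A → List B) where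

  Unique-concatMap⁻ : ∀ {xs k} → Unique (concatMap f xs) → k ∈ xs → Unique (f k)
  Unique-concatMap⁻ {x ∷ _} u (here refl) = proj₁ (Unique-++⁻ (f x) u)
  Unique-concatMap⁻ {x ∷ _} u (there k∈) =
    Unique-concatMap⁻ (proj₁ (proj₂ (Unique-++⁻ (f x) u))) k∈

  Unique-concatMap⇒disjoint : ∀ {xs k k′ z} → Unique (concatMap f xs) → k ∈ xs → k′ ∈ xs →
                              z ∈ f k → z ∈ f k′ → k ≡ k′
  Unique-concatMap⇒disjoint {x ∷ xs} u k∈ k′∈ z∈ z∈′ with Unique-++⁻ (f x) u | k∈ | k′∈
  ... | _ , _ , _        | here refl  | here refl   = refl
  ... | _ , _ , disjoint | here refl  | there k′∈xs =
    ⊥-elim (disjoint z∈ (∈-concatMap⁺ f (lose k′∈xs z∈′)))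
  ... | _ , _ , disjoint | there k∈xs | here refl   =
    ⊥-elim (disjoint z∈′ (∈-concatMap⁺ f (lose k∈xs z∈)))
  ... | _ , u′ , _       | there k∈xs | there k′∈xs =
    Unique-concatMap⇒disjoint u′ k∈xs k′∈xs z∈ z∈′

Finite-image : {A : Set} {P : A → Set} {Q : ℕ → Set} (R : A → ℕ → Set) → Finite P →
               (∀ {x} → P x → ∃ (R x)) → (∀ {x e e′} → R x e → R x e′ → e ≡ e′) →
               (∀ {x e} → P x → R x e → Q e) → (∀ {e} → Q e → ∃ λ x → P x × R x e) → Finite Q
Finite-image {Q = Q} R (_ , xs , _ , xs⊆P , P⊆xs , _) total functional image⊆Q Q⊆image =
  length es , es , deduplicate-! images , es⊆Q , Q⊆es , refl
  where
  value : ∀ {x} → x ∈ xs → ℕ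
  value x∈ = proj₁ (total (xs⊆P _ x∈))

  images es : List ℕ
  images = mapWith∈ xs value
  es = deduplicate _≟_ images

  es⊆Q : ∀ e → e ∈ es → Q e
  es⊆Q e e∈ with mapWith∈⁻ xs value (∈-deduplicate⁻ _≟_ images e∈)
  ... | x , x∈ , refl = image⊆Q (xs⊆P x x∈) (proj₂ (total (xs⊆P x x∈)))

  Q⊆es : ∀ e → Q e → e ∈ es
  Q⊆es e qe with Q⊆image qe
  ... | x , px , rxe = ∈-deduplicate⁺ _≟_
        (mapWith∈⁺ value (x , P⊆xs x px , functional rxe (proj₂ (total (xs⊆P x (P⊆xs x px))))))

module _ {E : ℕ → ℕ → Set} where

  PathIn-∷ʳ : ∀ {x y z vs} → PathIn E x y vs → E y z → ∃ (PathIn E x z)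
  PathIn-∷ʳ one         e = _ , cons e one
  PathIn-∷ʳ (cons e′ p) e = _ , cons e′ (proj₂ (PathIn-∷ʳ p e))

  PathIn-reverse : Symmetric E → ∀ {x z vs} → PathIn E x z vs → ∃ (PathIn E z x)
  PathIn-reverse sym-E one        = _ , one
  PathIn-reverse sym-E (cons e p) = PathIn-∷ʳ (proj₂ (PathIn-reverse sym-E p)) (sym-E e)

  PathIn-++ : ∀ {x y z vs ws} → PathIn E x y vs → PathIn E y z ws → ∃ (PathIn E x z)
  PathIn-++ one        q = _ , q
  PathIn-++ (cons e p) q = _ , cons e (proj₂ (PathIn-++ p q))

  PathIn-head : ∀ {P : ℕ → Set} {y z ws} → PathIn E y z ws → All P ws → P y
  PathIn-head one        (py ∷ _) = py
  PathIn-head (cons _ _) (py ∷ _) = py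

  SimplePath : ℕ → ℕ → Set
  SimplePath x z = ∃ λ vs → PathIn E x z vs × Unique vs

  SimplePath-suffix : ∀ {x y z ws} → PathIn E y z ws → Unique ws → x ∈ ws → SimplePath x z
  SimplePath-suffix one        u       (here refl) = _ , one , [] ∷ []
  SimplePath-suffix (cons e p) u       (here refl) = _ , cons e p , u
  SimplePath-suffix (cons e p) (_ ∷ u) (there x∈)  = SimplePath-suffix p u x∈

  PathIn⇒SimplePath : ∀ {x z vs} → PathIn E x z vs → SimplePath x z
  PathIn⇒SimplePath one = _ , one , [] ∷ []
  PathIn⇒SimplePath {x} (cons e p) with PathIn⇒SimplePath p
  ... | us , q , u with x ∈? us
  ...   | yes x∈us = SimplePath-suffix q u x∈us
  ...   | no  x∉us = x ∷ us , cons e q , ¬Any⇒All¬ us x∉us ∷ u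

Address : ℕ → Set
Address m = List (Fin (suc m))

addressDrift : ∀ {m} → Address m → ℕ
addressDrift ks = sum (map toℕ ks)

addressDrift-++ : ∀ {m} (ks ks′ : Address m) →
                  addressDrift (ks ++ ks′) ≡ addressDrift ks + addressDrift ks′
addressDrift-++ ks ks′ = trans (cong sum (map-++ toℕ ks ks′)) (sum-++ (map toℕ ks) (map toℕ ks′))

data NodeAt {m} (j : ℕ) (c : Fin (suc m) → Tree m) : Address m → Tree m → Set where
  here  : NodeAt j c [] (node j c)
  there : ∀ {l d ks} (k : Fin (suc m)) → NodeAt j c ks (d k) → NodeAt j c (k ∷ ks) (node l d)

module _ {m : ℕ} where

  childLabels : (Fin (suc m) → Tree m) → List ℕ
  childLabels d = concatMap (λ k → labels (d k)) (allFin (suc m))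

  NodeAt⇒∈labels : ∀ {j c ks t} → NodeAt j c ks t → j ∈ labels t
  NodeAt⇒∈childLabels : ∀ {j c ks d} k → NodeAt j c ks (d k) → j ∈ childLabels d

  NodeAt⇒∈labels here        = here refl
  NodeAt⇒∈labels (there k p) = there (NodeAt⇒∈childLabels k p)

  NodeAt⇒∈childLabels {d = d} k p =
    ∈-concatMap⁺ (λ k → labels (d k)) (lose (∈-allFin k) (NodeAt⇒∈labels p))

  ∈labels⇒NodeAt : ∀ {t : Tree m} {j} → j ∈ labels t →
                   ∃ λ c → Σ (Address m) λ ks → NodeAt j c ks t
  ∈labels⇒NodeAt {node _ d} (here refl) = d , [] , here
  ∈labels⇒NodeAt {node _ d} (there j∈)
    with satisfied (∈-concatMap⁻ (λ k → labels (d k)) {xs = allFin (suc m)} j∈)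
  ... | k , j∈dk with ∈labels⇒NodeAt j∈dk
  ...   | c , ks , p = c , k ∷ ks , there k p

  NodeIn⇒NodeAt : ∀ {t : Tree m} {j c} → NodeIn j c t → Σ (Address m) λ ks → NodeAt j c ks t
  NodeIn⇒NodeAt here = [] , here
  NodeIn⇒NodeAt (there k p) with NodeIn⇒NodeAt p
  ... | ks , q = k ∷ ks , there k q

  NodeAt⇒NodeIn : ∀ {t : Tree m} {j c ks} → NodeAt j c ks t → NodeIn j c t
  NodeAt⇒NodeIn here        = here
  NodeAt⇒NodeIn (there k p) = there k (NodeAt⇒NodeIn p)

  NodeIn-∘ : ∀ {t : Tree m} {y c x e} → NodeIn y c t → NodeIn x e (node y c) → NodeIn x e t
  NodeIn-∘ here        q = q
  NodeIn-∘ (there k p) q = there k (NodeIn-∘ p q)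

  NodeAt-∘ : ∀ {t : Tree m} {y c ks x e ks′} → NodeAt y c ks t → NodeAt x e ks′ (node y c) →
             NodeAt x e (ks ++ ks′) t
  NodeAt-∘ here        q = q
  NodeAt-∘ (there k p) q = there k (NodeAt-∘ p q)

  child-NodeAt : ∀ {p} {cp : Fin (suc m) → Tree m} {x e} s → cp s ≡ node x e →
                 NodeAt x e (s ∷ []) (node p cp)
  child-NodeAt s eq = there s (subst (NodeAt _ _ []) (sym eq) here)

  child-NodeIn : ∀ {p} {cp : Fin (suc m) → Tree m} {x e} s → cp s ≡ node x e → NodeIn x e (node p cp)
  child-NodeIn s eq = NodeAt⇒NodeIn (child-NodeAt s eq)

  NodeAt-label : ∀ {t : Tree m} {j j′ c c′ ks} → NodeAt j c ks t → NodeAt j′ c′ ks t → j ≡ j′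
  NodeAt-label here        here         = refl
  NodeAt-label (there k p) (there .k q) = NodeAt-label p q

  NodeAt-unique : ∀ {t : Tree m} {j c c′ ks ks′} → Unique (labels t) →
                  NodeAt j c ks t → NodeAt j c′ ks′ t → ks ≡ ks′ × c ≡ c′
  NodeAt-unique _          here        here        = refl , refl
  NodeAt-unique (j∉ ∷ _)   here        (there k q) = ⊥-elim (lookupᴬ j∉ (NodeAt⇒∈childLabels k q) refl)
  NodeAt-unique (j∉ ∷ _)   (there k p) here        = ⊥-elim (lookupᴬ j∉ (NodeAt⇒∈childLabels k p) refl)
  NodeAt-unique {node _ d} (_ ∷ u) (there k p) (there k′ q) with k ≟ᶠ k′
  ... | no k≢k′ = ⊥-elim (k≢k′ (Unique-concatMap⇒disjoint (λ k → labels (d k)) u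
                                  (∈-allFin k) (∈-allFin k′) (NodeAt⇒∈labels p) (NodeAt⇒∈labels q)))
  ... | yes refl with NodeAt-unique (Unique-concatMap⁻ (λ k → labels (d k)) u (∈-allFin k)) p q
  ...   | refl , refl = refl , refl

  NodeIn-unique : ∀ {t : Tree m} {j c c′} → Unique (labels t) →
                  NodeIn j c t → NodeIn j c′ t → c ≡ c′
  NodeIn-unique u p q = proj₂ (NodeAt-unique u (proj₂ (NodeIn⇒NodeAt p)) (proj₂ (NodeIn⇒NodeAt q)))

  Drift⇒NodeAt : ∀ {t : Tree m} {j e} → Drift j e t →
                 ∃ λ c → Σ (Address m) λ ks → NodeAt j c ks t × e ≡ addressDrift ks
  Drift⇒NodeAt (here {c}) = c , [] , here , refl
  Drift⇒NodeAt (there k p) with Drift⇒NodeAt p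
  ... | c , ks , q , refl = c , k ∷ ks , there k q , refl

  NodeAt⇒Drift : ∀ {t : Tree m} {j c ks} → NodeAt j c ks t → Drift j (addressDrift ks) t
  NodeAt⇒Drift here        = here
  NodeAt⇒Drift (there k p) = there k (NodeAt⇒Drift p)

  Drift-unique : ∀ {t : Tree m} {j e e′} → Unique (labels t) →
                 Drift j e t → Drift j e′ t → e ≡ e′
  Drift-unique u p q with Drift⇒NodeAt p | Drift⇒NodeAt q
  ... | _ , _ , p′ , refl | _ , _ , q′ , refl with NodeAt-unique u p′ q′
  ...   | refl , _ = refl

  Ancestor⇒Drift : ∀ {T : Tree m} {a j} → Ancestor T a j →
                   ∃ λ da → ∃ λ ej → Drift a da T × Drift j (da + ej) T
  Ancestor⇒Drift (_ , a-in , _ , j-in) with NodeIn⇒NodeAt a-in | NodeIn⇒NodeAt j-in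
  ... | ka , a-at | kj , j-at =
    addressDrift ka , addressDrift kj , NodeAt⇒Drift a-at ,
    subst (λ e → Drift _ e _) (addressDrift-++ ka kj) (NodeAt⇒Drift (NodeAt-∘ a-at j-at))

  ChildOf⇒NodeAt : ∀ {T : Tree m} {s x p} → ChildOf T s x p →
                   Σ (Address m) λ kp → ∃ λ cp → ∃ λ cx → NodeAt p cp kp T × NodeAt x cx (kp ∷ʳ s) T
  ChildOf⇒NodeAt {s = s} (cp , p-in , cx , eq) with NodeIn⇒NodeAt p-in
  ... | kp , p-at = kp , cp , cx , p-at , NodeAt-∘ p-at (child-NodeAt s eq)

  Parent : Tree m → ℕ → ℕ → Set
  Parent t x p = Σ (Fin (suc m)) λ s → ChildOf t s x p

  Adj⇒Parent : ∀ {t : Tree m} {x y} → Adj t x y → Parent t x y ⊎ Parent t y x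
  Adj⇒Parent (s , inj₁ c) = inj₁ (s , c)
  Adj⇒Parent (s , inj₂ c) = inj₂ (s , c)

  Adj-sym : {t : Tree m} → Symmetric (Adj t)
  Adj-sym (s , inj₁ c) = s , inj₂ c
  Adj-sym (s , inj₂ c) = s , inj₁ c

  PathIn-below : ∀ {t : Tree m} {l d x c u} k → NodeIn l d t → d k ≡ u → NodeIn x c u →
                 ∃ (PathIn (Adj t) l x)
  PathIn-below k l-in eq here = _ , cons (k , inj₂ (_ , l-in , _ , eq)) one
  PathIn-below k l-in eq (there k′ x-in) =
    _ , cons (k , inj₂ (_ , l-in , _ , eq))
             (proj₂ (PathIn-below k′ (NodeIn-∘ l-in (child-NodeIn k eq)) refl x-in))

  PathIn-fromRoot : ∀ {r d x c} → NodeIn x c (node r d) → ∃ (PathIn (Adj (node r d)) r x)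
  PathIn-fromRoot here           = _ , one
  PathIn-fromRoot (there k x-in) = PathIn-below k here refl x-in

  TreePath-exists : ∀ {t : Tree m} {x cx y cy} → NodeIn x cx t → NodeIn y cy t → ∃ (TreePath t x y)
  TreePath-exists {node r d} x-in y-in =
    PathIn⇒SimplePath (proj₂ (PathIn-++ (proj₂ (PathIn-reverse Adj-sym (proj₂ (PathIn-fromRoot x-in))))
                                        (proj₂ (PathIn-fromRoot y-in))))

module _ {E : ℕ → ℕ → Set} {μ : List (ℕ × ℕ)} where

  EdgesIn-∷ : ∀ {x y z ws} → InMu μ x y → PathIn E y z ws → EdgesIn μ ws → EdgesIn μ (x ∷ ws)
  EdgesIn-∷ xy one        _  = cons xy sing
  EdgesIn-∷ xy (cons _ _) es = cons xy es

  EdgesIn-uncons : ∀ {x y z ws} → EdgesIn μ (x ∷ ws) → PathIn E y z ws → InMu μ x y × EdgesIn μ ws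
  EdgesIn-uncons (cons xy es) one        = xy , es
  EdgesIn-uncons (cons xy es) (cons _ _) = xy , es

InMu-sym : ∀ {μ x y} → InMu μ x y → InMu μ y x
InMu-sym (inj₁ xy∈μ) = inj₂ xy∈μ
InMu-sym (inj₂ yx∈μ) = inj₁ yx∈μ

module UniqueLabels {m : ℕ} (T : Tree m) (U : Unique (labels T)) where

  Parent⇒NodeAt : ∀ {x p} → Parent T x p → ∃ λ cp → Σ (Address m) λ kp → NodeAt p cp kp T
  Parent⇒NodeAt (_ , ch) with ChildOf⇒NodeAt ch
  ... | kp , cp , _ , p-at , _ = cp , kp , p-at

  Parent-unique : ∀ {x p p′} → Parent T x p → Parent T x p′ → p ≡ p′
  Parent-unique (_ , ch) (_ , ch′) with ChildOf⇒NodeAt ch | ChildOf⇒NodeAt ch′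
  ... | kp , _ , _ , p-at , x-at | kp′ , _ , _ , p′-at , x-at′
    with ∷ʳ-injective kp kp′ (proj₁ (NodeAt-unique U x-at x-at′))
  ...   | refl , refl = NodeAt-label p-at p′-at

  Parent-depth : ∀ {x p cx cp kx kp} → Parent T x p → NodeAt x cx kx T → NodeAt p cp kp T →
                 length kx ≡ suc (length kp)
  Parent-depth (_ , ch) x-at p-at with ChildOf⇒NodeAt ch
  ... | kp , _ , _ , p-at′ , x-at′ with NodeAt-unique U x-at x-at′ | NodeAt-unique U p-at p-at′
  ...   | refl , _ | refl , _ = trans (length-++ kp) (+-comm (length kp) 1)

  data Descendant : ℕ → ℕ → Set where
    self : ∀ {x} → Descendant x x
    up   : ∀ {x p a} → Parent T x p → Descendant p a → Descendant x a

  Descendant-trans : ∀ {x y z} → Descendant x y → Descendant y z → Descendant x z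
  Descendant-trans self       q = q
  Descendant-trans (up par r) q = up par (Descendant-trans r q)

  Descendant-depth : ∀ {x a cx ca kx ka} → Descendant x a → NodeAt x cx kx T → NodeAt a ca ka T →
                     length ka ≤ length kx
  Descendant-depth self x-at a-at with NodeAt-unique U x-at a-at
  ... | refl , _ = ≤-refl
  Descendant-depth (up par r) x-at a-at with Parent⇒NodeAt par
  ... | _ , _ , p-at = ≤-trans (Descendant-depth r p-at a-at)
                               (≤-trans (n≤1+n _) (≤-reflexive (sym (Parent-depth par x-at p-at))))

  Parent-acyclic : ∀ {a p} → Parent T a p → Descendant p a → ⊥
  Parent-acyclic (s , ch) r with ChildOf⇒NodeAt ch
  ... | kp , _ , _ , p-at , a-at =
    <-irrefl refl (subst (_≤ length kp) (Parent-depth (s , ch) a-at p-at) (Descendant-depth r p-at a-at))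

  Descendant-antisym : ∀ {x a} → Descendant x a → Descendant a x → x ≡ a
  Descendant-antisym self       _ = refl
  Descendant-antisym (up par r) q = ⊥-elim (Parent-acyclic par (Descendant-trans r q))

  Descendant⇒NodeIn : ∀ {x a c} → Descendant x a → NodeIn x c T → ∃ λ c′ → NodeIn a c′ T
  Descendant⇒NodeIn self                     x-in = _ , x-in
  Descendant⇒NodeIn (up (_ , _ , p-in , _) r) _    = Descendant⇒NodeIn r p-in

  Descendant⇒Ancestor : ∀ {j a c} → Descendant j a → NodeIn a c T → Ancestor T a j
  Descendant⇒Ancestor self a-in = _ , a-in , _ , here
  Descendant⇒Ancestor (up (s , _ , p-in , e , eq) r) a-in with Descendant⇒Ancestor r a-in
  ... | _ , a-in′ , _ , p-in′ with NodeIn-unique U p-in (NodeIn-∘ a-in′ p-in′)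
  ...   | refl = _ , a-in′ , e , NodeIn-∘ p-in′ (child-NodeIn s eq)

  Descendant-pathStart : ∀ {a w j ws} → PathIn (Adj T) w j ws → All (a ≢_) ws →
                         Descendant j a → Descendant w a
  Descendant-pathStart one _ j≤a = j≤a
  Descendant-pathStart (cons wy rest) (_ ∷ a∉rest) j≤a
    with Adj⇒Parent wy | Descendant-pathStart rest a∉rest j≤a
  ... | inj₁ w→y | y≤a = up w→y y≤a
  ... | inj₂ y→w | self = ⊥-elim (PathIn-head rest a∉rest refl)
  ... | inj₂ y→w | up y→p p≤a = subst (λ p → Descendant p _) (Parent-unique y→p y→w) p≤a

  Descendant-pathEnd : ∀ {x y w j ws} → Parent T y x → PathIn (Adj T) w j ws → All (x ≢_) ws →
                       Descendant w y → Descendant j y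
  Descendant-pathEnd y→x one _ w≤y = w≤y
  Descendant-pathEnd y→x (cons wv rest) (_ ∷ x∉rest) w≤y with Adj⇒Parent wv | w≤y
  ... | inj₂ v→w | _ = Descendant-pathEnd y→x rest x∉rest (up v→w w≤y)
  ... | inj₁ w→v | self = ⊥-elim (PathIn-head rest x∉rest (Parent-unique y→x w→v))
  ... | inj₁ w→v | up w→p p≤y =
    Descendant-pathEnd y→x rest x∉rest (subst (λ p → Descendant p _) (Parent-unique w→p w→v) p≤y)

module MarkedBlocks {m : ℕ} (T : Tree m) (U : Unique (labels T)) (μ : List (ℕ × ℕ))
  (marked⇒Parent : ∀ {j i} → (j , i) ∈ μ → Parent T i j) where

  open UniqueLabels T U

  data MarkedDescendant : ℕ → ℕ → Set where
    self : ∀ {x} → MarkedDescendant x x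
    up   : ∀ {x p a} → Parent T x p → InMu μ x p → MarkedDescendant p a → MarkedDescendant x a

  Top : ℕ → Set
  Top a = ∀ {p} → Parent T a p → ¬ InMu μ a p

  MarkedDescendant⇒Descendant : ∀ {x a} → MarkedDescendant x a → Descendant x a
  MarkedDescendant⇒Descendant self         = self
  MarkedDescendant⇒Descendant (up x→p _ r) = up x→p (MarkedDescendant⇒Descendant r)

  MarkedDescendant-Top : ∀ {x a} → Top x → MarkedDescendant x a → x ≡ a
  MarkedDescendant-Top _   self              = refl
  MarkedDescendant-Top top (up x→p marked _) = ⊥-elim (top x→p marked)

  marked-parent? : ∀ x → Dec (∃ λ p → (p , x) ∈ μ)
  marked-parent? x with any? (λ e → proj₂ e ≟ x) μ
  ... | no none = no λ (_ , px∈μ) → none (lose px∈μ refl)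
  ... | yes some with find some
  ...   | (p , _) , px∈μ , refl = yes (p , px∈μ)

  no-marked-parent⇒Top : ∀ {x} → ¬ (∃ λ p → (p , x) ∈ μ) → Top x
  no-marked-parent⇒Top _    x→p (inj₁ xp∈μ) = Parent-acyclic x→p (up (marked⇒Parent xp∈μ) self)
  no-marked-parent⇒Top none _   (inj₂ px∈μ) = none (_ , px∈μ)

  private
    parent-fuel : ∀ {x p cx cp kx kp f} → Parent T x p → NodeAt x cx kx T → NodeAt p cp kp T →
                  length kx < suc f → length kp < f
    parent-fuel x→p x-at p-at lt = ≤-pred (subst (_< suc _) (Parent-depth x→p x-at p-at) lt)

    climb : ∀ f {x cx kx} → NodeAt x cx kx T → length kx < f →
            ∃ λ a → MarkedDescendant x a × Top a
    climb (suc f) {x} x-at lt with marked-parent? x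
    ... | no none = x , self , no-marked-parent⇒Top none
    ... | yes (_ , px∈μ) with Parent⇒NodeAt (marked⇒Parent px∈μ)
    ...   | _ , _ , p-at with climb f p-at (parent-fuel (marked⇒Parent px∈μ) x-at p-at lt)
    ...     | a , p⇝a , top = a , up (marked⇒Parent px∈μ) (inj₂ px∈μ) p⇝a , top

    decide : ∀ a f {j cj kj} → NodeAt j cj kj T → length kj < f → Dec (MarkedDescendant j a)
    decide a (suc f) {j} j-at lt with j ≟ a
    ... | yes refl = yes self
    ... | no j≢a with marked-parent? j
    ...   | no none = no λ j⇝a → j≢a (MarkedDescendant-Top (no-marked-parent⇒Top none) j⇝a)
    ...   | yes (_ , pj∈μ) with Parent⇒NodeAt (marked⇒Parent pj∈μ)
    ...     | _ , _ , p-at with decide a f p-at (parent-fuel (marked⇒Parent pj∈μ) j-at p-at lt)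
    ...       | yes p⇝a = yes (up (marked⇒Parent pj∈μ) (inj₂ pj∈μ) p⇝a)
    ...       | no ¬p⇝a = no λ where
      self             → j≢a refl
      (up j→p′ _ p′⇝a) →
        ¬p⇝a (subst (λ p → MarkedDescendant p a) (Parent-unique j→p′ (marked⇒Parent pj∈μ)) p′⇝a)

  ∃-Top : ∀ {x cx kx} → NodeAt x cx kx T → ∃ λ a → MarkedDescendant x a × Top a
  ∃-Top x-at = climb _ x-at (n<1+n _)

  markedDescendant? : ∀ a {j cj kj} → NodeAt j cj kj T → Dec (MarkedDescendant j a)
  markedDescendant? a j-at = decide a _ j-at (n<1+n _)

  MarkedDescendant-between : ∀ {a j y} → MarkedDescendant j a → Descendant j y → Descendant y a →
                             MarkedDescendant y a
  MarkedDescendant-between self j≤y y≤a =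
    subst (λ y → MarkedDescendant y _) (Descendant-antisym j≤y y≤a) self
  MarkedDescendant-between (up j→p mark r) self        _   = up j→p mark r
  MarkedDescendant-between (up j→p _ r)    (up j→p′ p′≤y) y≤a =
    MarkedDescendant-between r (subst (λ p → Descendant p _) (Parent-unique j→p′ j→p) p′≤y) y≤a

  MarkedDescendant⇒marked-path : ∀ {a x j vs} → MarkedDescendant x a → MarkedDescendant j a →
                                 PathIn (Adj T) x j vs → Unique vs → EdgesIn μ vs
  MarkedDescendant⇒marked-path _ _ one _ = sing
  MarkedDescendant⇒marked-path x⇝a j⇝a (cons xy rest) (x∉rest ∷ u) with Adj⇒Parent xy | x⇝a
  ... | inj₁ x→y | self =
    ⊥-elim (Parent-acyclic x→y (Descendant-pathStart rest x∉rest (MarkedDescendant⇒Descendant j⇝a)))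
  ... | inj₁ x→y | up x→p mark p⇝a with Parent-unique x→p x→y
  ...   | refl = EdgesIn-∷ mark rest (MarkedDescendant⇒marked-path p⇝a j⇝a rest u)
  MarkedDescendant⇒marked-path x⇝a j⇝a (cons xy rest) (x∉rest ∷ u) | inj₂ y→x | _
    with MarkedDescendant-between j⇝a (Descendant-pathEnd y→x rest x∉rest self)
                                       (up y→x (MarkedDescendant⇒Descendant x⇝a))
  ... | self = ⊥-elim (Parent-acyclic y→x (MarkedDescendant⇒Descendant x⇝a))
  ... | up y→p mark p⇝a with Parent-unique y→p y→x
  ...   | refl =
    EdgesIn-∷ (InMu-sym mark) rest (MarkedDescendant⇒marked-path (up y→p mark p⇝a) j⇝a rest u)

  marked-path⇒MarkedDescendant : ∀ {a x j vs} → Top a → MarkedDescendant x a →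
                                 PathIn (Adj T) x j vs → EdgesIn μ vs → MarkedDescendant j a
  marked-path⇒MarkedDescendant _ x⇝a one _ = x⇝a
  marked-path⇒MarkedDescendant top x⇝a (cons xy rest) es
    with EdgesIn-uncons es rest | Adj⇒Parent xy | x⇝a
  ... | mark , es′ | inj₂ y→x | _ =
    marked-path⇒MarkedDescendant top (up y→x (InMu-sym mark) x⇝a) rest es′
  ... | mark , _   | inj₁ x→y | self = ⊥-elim (top x→y mark)
  ... | _ , es′    | inj₁ x→y | up x→p _ p⇝a with Parent-unique x→p x→y
  ...   | refl = marked-path⇒MarkedDescendant top p⇝a rest es′

module _ {n : ℕ} where

  InRange? : ∀ j → Dec (InRange n j)
  InRange? j = (1 ≤? j) ×-dec (j ≤? n)

  InRange⇒∈ : ∀ {j} → InRange n j → j ∈ map suc (upTo n)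
  InRange⇒∈ {suc k} (_ , j≤n) = ∈-map⁺ suc (∈-upTo⁺ j≤n)

  ∈⇒InRange : ∀ {j} → j ∈ map suc (upTo n) → InRange n j
  ∈⇒InRange j∈ with ∈-map⁻ suc j∈
  ... | _ , k∈ , refl = s≤s z≤n , ∈-upTo⁻ k∈

  module _ {m : ℕ} {T : Tree m} (labelled : LabeledBy n T) where

    LabeledBy⇒Unique : Unique (labels T)
    LabeledBy⇒Unique =
      Unique-resp-↭ (setoid ℕ) (↭⇒↭ₛ (↭-sym labelled)) (map⁺ suc-injective (upTo⁺ n))

    InRange⇒NodeAt : ∀ {j} → InRange n j → ∃ λ c → Σ (Address m) λ ks → NodeAt j c ks T
    InRange⇒NodeAt rj = ∈labels⇒NodeAt (∈-resp-↭ (↭-sym labelled) (InRange⇒∈ rj))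

    NodeAt⇒InRange : ∀ {j c ks} → NodeAt j c ks T → InRange n j
    NodeAt⇒InRange j-at = ∈⇒InRange (∈-resp-↭ labelled (NodeAt⇒∈labels j-at))

MarkedTree⇒Parent : ∀ {m n T μ} → MarkedTree m n T μ → ∀ {j i} → (j , i) ∈ μ → Parent T i j
MarkedTree⇒Parent (_ , cadets) {j} {i} ji∈μ with cadets j i ji∈μ
... | s , (c , j-in , i-root , _) , _ = s , c , j-in , i-root

shift-difference : ∀ a d e → (+ (a + d)) - (+ (a + e)) ≡ (+ d) - (+ e)
shift-difference a d e = begin
  (+ (a + d)) - (+ (a + e)) ≡⟨ m-n≡m⊖n (a + d) (a + e) ⟩
  (a + d) ⊖ (a + e)         ≡⟨ +-cancelˡ-⊖ a d e ⟩
  d ⊖ e                     ≡⟨ sym (m-n≡m⊖n d e) ⟩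
  (+ d) - (+ e)             ∎
  where open ≡-Reasoning

module Shadows (S : List ℤ) (symS : SymmetricSet S) {m : ℕ} (n : ℕ) (T : Tree m)
  (μ : List (ℕ × ℕ)) (marked : MarkedTree m n T μ) where

  private
    U : Unique (labels T)
    U = LabeledBy⇒Unique (proj₁ marked)

  open UniqueLabels T U
  open MarkedBlocks T U μ (MarkedTree⇒Parent marked)

  ShadowEdge : ℕ → ℕ → Set
  ShadowEdge d d′ = ((+ d) - (+ d′)) ∈ S

  BlockEdge : ℕ → ℕ → Set
  BlockEdge = DriftEdge S n T

  ShadowEdge-sym : ∀ {d d′} → ShadowEdge d d′ → ShadowEdge d′ d
  ShadowEdge-sym {d} {d′} e = subst (_∈ S) (⁻¹-anti-homo‿- (+ d) (+ d′)) (proj₁ (symS _) e)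

  ShadowEdge-refl : ∀ {d} → (+ 0) ∈ S → ShadowEdge d d
  ShadowEdge-refl {d} 0∈S = subst (_∈ S) (sym (+-inverseʳ (+ d))) 0∈S

  ShadowEdge-irrefl : ∀ {d} → (+ 0) ∉ S → ¬ ShadowEdge d d
  ShadowEdge-irrefl {d} 0∉S e = 0∉S (subst (_∈ S) (+-inverseʳ (+ d)) e)

  InArrangement⇒∈ : ∀ {u w c} → InArrangement S n u w c → c ∈ S
  InArrangement⇒∈ (inj₁ (_ , _ , _ , c∈S))  = c∈S
  InArrangement⇒∈ (inj₂ (_ , _ , _ , -c∈S)) = proj₂ (symS _) -c∈S

  BlockEdge⇒ShadowEdge : ∀ {u w du dw} → BlockEdge u w → Drift u du T → Drift w dw T →
                         ShadowEdge du dw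
  BlockEdge⇒ShadowEdge (_ , _ , Du′ , Dw′ , arr) Du Dw
    with Drift-unique U Du′ Du | Drift-unique U Dw′ Dw
  ... | refl | refl = InArrangement⇒∈ arr

  ShadowEdge⇒BlockEdge : ∀ {u w du dw} → InRange n u → InRange n w → u ≢ w →
                         Drift u du T → Drift w dw T → ShadowEdge du dw → BlockEdge u w
  ShadowEdge⇒BlockEdge {u} {w} (1≤u , u≤n) (1≤w , w≤n) u≢w Du Dw e = _ , _ , Du , Dw , arrangement
    where
    arrangement : InArrangement S n u w _
    arrangement with <-cmp u w
    ... | tri< u<w _ _ = inj₁ (1≤u , u<w , w≤n , e)
    ... | tri≈ _ u≡w _ = ⊥-elim (u≢w u≡w)
    ... | tri> _ _ w<u = inj₂ (1≤w , w<u , u≤n , proj₁ (symS _) e)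

  module _ (i : ℕ) where

    B : ℕ → Set
    B = Block T μ n i

    Sh : ℕ → Set
    Sh = Shadow T μ n i

    Root : ℕ → Set
    Root a = B a × (∀ j → B j → Ancestor T a j)

    Sh⇒Root : ∀ {d} → Sh d → ∃ λ a → ∃ λ da → Root a × Drift a da T
    Sh⇒Root (a , ba , anc , _ , _ , da , _ , Da , _) = a , da , (ba , anc) , Da

    Root-drift-unique : ∀ {a a′ da da′} → Root a → Root a′ →
                        Drift a da T → Drift a′ da′ T → da ≡ da′
    Root-drift-unique {da = da} {da′} (ba , anc) (ba′ , anc′) Da Da′
      with Ancestor⇒Drift (anc _ ba′) | Ancestor⇒Drift (anc′ _ ba)
    ... | _ , e , Da″ , Da′″ | _ , e′ , Da′‴ , Da⁗
      with Drift-unique U Da″ Da | Drift-unique U Da′‴ Da′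
    ... | refl | refl =
      ≤-antisym (subst (da ≤_) (Drift-unique U Da′″ Da′) (m≤m+n da e))
                (subst (da′ ≤_) (Drift-unique U Da⁗ Da) (m≤m+n da′ e′))

    module Rooted {a da : ℕ} (root : Root a) (Da : Drift a da T) where

      offset : ∀ {x} → B x → ∃ λ e → Drift x (da + e) T
      offset bx with Ancestor⇒Drift (proj₂ root _ bx)
      ... | _ , e , Da′ , Dx with Drift-unique U Da′ Da
      ...   | refl = e , Dx

      member⇒Sh : ∀ {x e} → B x → Drift x (da + e) T → Sh e
      member⇒Sh bx Dx = _ , proj₁ root , proj₂ root , _ , bx , _ , _ , Da , Dx , refl

      Sh⇒member : ∀ {e} → Sh e → ∃ λ w → B w × Drift w (da + e) T
      Sh⇒member (_ , ba′ , anc′ , w , bw , _ , _ , Da′ , Dw , refl)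
        with Root-drift-unique (ba′ , anc′) root Da′ Da
      ... | refl = w , bw , Dw

      offset-edge : ∀ {u w d d′} → B u → B w → u ≢ w → Drift u (da + d) T → Drift w (da + d′) T →
                    ShadowEdge d d′ → BlockEdge u w
      offset-edge {d = d} {d′} bu bw u≢w Du Dw e =
        ShadowEdge⇒BlockEdge (proj₁ bu) (proj₁ bw) u≢w Du Dw
                             (subst (_∈ S) (sym (shift-difference da d d′)) e)

      edge-offset : ∀ {u w d d′} → BlockEdge u w → Drift u (da + d) T → Drift w (da + d′) T →
                    ShadowEdge d d′
      edge-offset {d = d} {d′} uw Du Dw =
        subst (_∈ S) (shift-difference da d d′) (BlockEdge⇒ShadowEdge uw Du Dw)

      offset-unique : ∀ {x e e′} → Drift x (da + e) T → Drift x (da + e′) T → e ≡ e′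
      offset-unique Dx Dx′ = +-cancelˡ-≡ da _ _ (Drift-unique U Dx Dx′)

    SameDriftLinked : Set
    SameDriftLinked = ∀ {u v d} → B u → B v → Drift u d T → Drift v d T → Reach B BlockEdge u v

    0∈S⇒SameDriftLinked : (+ 0) ∈ S → SameDriftLinked
    0∈S⇒SameDriftLinked 0∈S {u} {v} {d} bu bv Du Dv with u ≟ v
    ... | yes refl = stop
    ... | no  u≢v  =
      step (ShadowEdge⇒BlockEdge (proj₁ bu) (proj₁ bv) u≢v Du Dv (ShadowEdge-refl {d} 0∈S)) bv stop

    singleton⇒SameDriftLinked : HasSize B 1 → SameDriftLinked
    singleton⇒SameDriftLinked B-size {u} bu bv _ _ =
      subst (Reach B BlockEdge u) (HasSize≤1⇒≡ B-size ≤-refl bu bv) stop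

    spread⇒SameDriftLinked : (+ 0) ∉ S → IsSShadow S Sh → (∃ λ k → HasSize Sh k × 1 < k) →
                             SameDriftLinked
    spread⇒SameDriftLinked 0∉S (_ , Sh-0 , Sh-connected)
                           (_ , (es , es-unique , es⊆Sh , _ , refl) , 1<k) {u} {v} bu bv Du Dv
      with Sh⇒Root Sh-0
    ... | _ , da , root , Da with Rooted.offset root Da bu
    ... | e , Du′ with Drift-unique U Du Du′
    ... | refl with ∃-other-member _≟_ es-unique 1<k e
    ... | e″ , e″∈es , e″≢e
      with Sh-connected e e″ (Rooted.member⇒Sh root Da bu Du) (es⊆Sh e″ e″∈es)
    ... | stop = ⊥-elim (e″≢e refl)
    ... | step {y = e₁} e—e₁ Sh-e₁ _ with Rooted.Sh⇒member root Da Sh-e₁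
    ... | w , bw , Dw =
      step (offset-edge bu bw u≢w Du Dw e—e₁) bw
           (step (offset-edge bw bv w≢v Dw Dv (ShadowEdge-sym {e} {e₁} e—e₁)) bv stop)
      where
      open Rooted root Da
      e≢e₁ : e ≢ e₁
      e≢e₁ refl = ShadowEdge-irrefl {e} 0∉S e—e₁
      u≢w : u ≢ w
      u≢w refl = e≢e₁ (offset-unique Du Dw)
      w≢v : w ≢ v
      w≢v refl = e≢e₁ (offset-unique Dv Dw)

    IsSShadow⇒Connected : IsSShadow S Sh → SameDriftLinked → Connected B BlockEdge
    IsSShadow⇒Connected (_ , Sh-0 , Sh-connected) linked x y bx by with Sh⇒Root Sh-0
    ... | _ , da , root , Da with Rooted.offset root Da bx | Rooted.offset root Da by
    ... | ex , Dx | ey , Dy =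
      lift (Sh-connected ex ey (member⇒Sh bx Dx) (member⇒Sh by Dy)) bx Dx by Dy
      where
      open Rooted root Da
      lift : ∀ {d d′} → Reach Sh ShadowEdge d d′ → ∀ {u v} → B u → Drift u (da + d) T →
             B v → Drift v (da + d′) T → Reach B BlockEdge u v
      lift stop bu Du bv Dv = linked bu bv Du Dv
      lift (step e Sh-d₁ rest) {u} bu Du bv Dv with Sh⇒member Sh-d₁
      ... | w , bw , Dw with u ≟ w
      ...   | yes refl = lift rest bu Dw bv Dv
      ...   | no  u≢w  = step (offset-edge bu bw u≢w Du Dw e) bw (lift rest bw Dw bv Dv)

    module OfNode (ri : InRange n i) where

      private
        i-at : ∃ λ c → Σ (Address m) λ ks → NodeAt i c ks T
        i-at = InRange⇒NodeAt (proj₁ marked) ri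

      -- Opaque because unfolding these choices makes with-abstractions over offsets normalise
      -- huge terms; only their types matter.
      opaque
        a : ℕ
        a = proj₁ (∃-Top (proj₂ (proj₂ i-at)))

        i⇝a : MarkedDescendant i a
        i⇝a = proj₁ (proj₂ (∃-Top (proj₂ (proj₂ i-at))))

        a-Top : Top a
        a-Top = proj₂ (proj₂ (∃-Top (proj₂ (proj₂ i-at))))

      MarkedDescendant⇒B : ∀ {j} → InRange n j → MarkedDescendant j a → B j
      MarkedDescendant⇒B rj j⇝a =
        rj , inj₂ λ _ (path , simple) → MarkedDescendant⇒marked-path i⇝a j⇝a path simple

      B⇒MarkedDescendant : ∀ {j} → B j → MarkedDescendant j a
      B⇒MarkedDescendant (_ , inj₁ refl) = i⇝a
      B⇒MarkedDescendant (rj , inj₂ all-marked)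
        with TreePath-exists (NodeAt⇒NodeIn (proj₂ (proj₂ i-at)))
                             (NodeAt⇒NodeIn (proj₂ (proj₂ (InRange⇒NodeAt (proj₁ marked) rj))))
      ... | vs , path , simple =
        marked-path⇒MarkedDescendant a-Top i⇝a path (all-marked vs (path , simple))

      block? : ∀ j → Dec (B j)
      block? j with InRange? {n} j
      ... | no ¬rj = no (¬rj ∘ proj₁)
      ... | yes rj with markedDescendant? a (proj₂ (proj₂ (InRange⇒NodeAt (proj₁ marked) rj)))
      ...   | yes j⇝a = yes (MarkedDescendant⇒B rj j⇝a)
      ...   | no ¬j⇝a = no (¬j⇝a ∘ B⇒MarkedDescendant)

      B-finite : Finite B
      B-finite = length bs , bs , filter⁺ block? (map⁺ suc-injective (upTo⁺ n)) , bs⊆B , B⊆bs , refl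
        where
        bs : List ℕ
        bs = filter block? (map suc (upTo n))
        bs⊆B : ∀ j → j ∈ bs → B j
        bs⊆B j j∈ = proj₂ (∈-filter⁻ block? {xs = map suc (upTo n)} j∈)
        B⊆bs : ∀ j → B j → j ∈ bs
        B⊆bs j bj = ∈-filter⁺ block? (InRange⇒∈ (proj₁ bj)) bj

      private
        a-in : ∃ λ c → NodeIn a c T
        a-in = Descendant⇒NodeIn (MarkedDescendant⇒Descendant i⇝a)
                                 (NodeAt⇒NodeIn (proj₂ (proj₂ i-at)))

      opaque
        da : ℕ
        da = addressDrift (proj₁ (NodeIn⇒NodeAt (proj₂ a-in)))

        Da : Drift a da T
        Da = NodeAt⇒Drift (proj₂ (NodeIn⇒NodeAt (proj₂ a-in)))

        root : Root a
        root = MarkedDescendant⇒B (NodeAt⇒InRange (proj₁ marked) (proj₂ (NodeIn⇒NodeAt (proj₂ a-in)))) self ,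
               λ j bj → Descendant⇒Ancestor (MarkedDescendant⇒Descendant (B⇒MarkedDescendant bj))
                                            (proj₂ a-in)

      open Rooted root Da

      Sh-0 : Sh 0
      Sh-0 = member⇒Sh (proj₁ root) (subst (λ d → Drift a d T) (sym (+-identityʳ da)) Da)

      opaque
        Sh-finite : Finite Sh
        Sh-finite = Finite-image (λ x e → Drift x (da + e) T) B-finite
                                 offset offset-unique member⇒Sh Sh⇒member

      Sh-connected : Connected B BlockEdge → Connected Sh ShadowEdge
      Sh-connected B-connected e e′ Sh-e Sh-e′ with Sh⇒member Sh-e | Sh⇒member Sh-e′
      ... | u , bu , Du | v , bv , Dv = project (B-connected u v bu bv) Du Dv
        where
        project : ∀ {u v d d′} → Reach B BlockEdge u v → Drift u (da + d) T → Drift v (da + d′) T →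
                  Reach Sh ShadowEdge d d′
        project stop Du Dv = subst (Reach Sh ShadowEdge _) (offset-unique Du Dv) stop
        project (step uw bw rest) Du Dv with offset bw
        ... | _ , Dw = step (edge-offset uw Du Dw) (member⇒Sh bw Dw) (project rest Dw Dv)

      Connected⇒IsSShadow : Connected B BlockEdge → IsSShadow S Sh
      Connected⇒IsSShadow B-connected = Sh-finite , Sh-0 , Sh-connected B-connected

      Connected⇒spread-or-singleton : (+ 0) ∉ S → Connected B BlockEdge →
                                      (∃ λ k → HasSize Sh k × 1 < k) ⊎ HasSize B 1
      Connected⇒spread-or-singleton 0∉S B-connected with Sh-finite
      ... | k , Sh-size with 1 <? k
      ... | yes 1<k = inj₁ (k , Sh-size , 1<k)
      ... | no  1≮k = inj₂ (i ∷ [] , [] ∷ [] , (λ { _ (here refl) → bi }) , B⊆[i] , refl)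
        where
        bi : B i
        bi = ri , inj₁ refl

        no-edge-at-i : ∀ {w} → BlockEdge i w → B w → ⊥
        no-edge-at-i iw bw with offset bi | offset bw
        ... | ei , Di | ew , Dw
          with HasSize≤1⇒≡ Sh-size (≤-pred (≰⇒> 1≮k)) (member⇒Sh bi Di) (member⇒Sh bw Dw)
        ... | refl = ShadowEdge-irrefl {ei} 0∉S (edge-offset iw Di Dw)

        B⊆[i] : ∀ x → B x → x ∈ i ∷ []
        B⊆[i] x bx with B-connected i x bi bx
        ... | stop         = here refl
        ... | step iw bw _ = ⊥-elim (no-edge-at-i iw bw)

lemma5p8 : (S : List ℤ) → SymmetricSet S → ComplSumAvoids S →
    (m : ℕ) → IsMax S m → (n : ℕ) → 1 ≤ n →
    (T : Tree m) (μ : List (ℕ × ℕ)) → MarkedTree m n T μ →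
    ((+ 0) ∈ S →
      (AConnected S n T μ ⇔
        (∀ i → InRange n i → IsSShadow S (Shadow T μ n i)))) ×
    ((+ 0) ∉ S →
      (AConnected S n T μ ⇔
        (∀ i → InRange n i → IsSShadow S (Shadow T μ n i) ×
          ((∃ λ k → HasSize (Shadow T μ n i) k × 1 < k) ⊎
           HasSize (Block T μ n i) 1))))
lemma5p8 S symS _ m _ n _ T μ marked =
  (λ 0∈S → mk⇔
    (λ conn i ri → OfNode.Connected⇒IsSShadow i ri (conn i ri))
    (λ shadows i ri → IsSShadow⇒Connected i (shadows i ri) (0∈S⇒SameDriftLinked i 0∈S))) ,
  (λ 0∉S → mk⇔
    (λ conn i ri → OfNode.Connected⇒IsSShadow i ri (conn i ri) ,
                   OfNode.Connected⇒spread-or-singleton i ri 0∉S (conn i ri))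
    (λ shadows i ri → IsSShadow⇒Connected i (proj₁ (shadows i ri))
       ([ spread⇒SameDriftLinked i 0∉S (proj₁ (shadows i ri)) , singleton⇒SameDriftLinked i ]′
          (proj₂ (shadows i ri)))))
  where open Shadows S symS n T μ marked
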